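{- Let $A\in\mathbb{R}^{m\times n}$ with $m\le n$, and let $p>n$. Then $A$ has the strong inner product property if and only if the $m\times p$ matrix $B=\left[\begin{array}{c|c}A & O\end{array}\right]$ (where $O$ is the $m\times(p-n)$ zero matrix) has the strong inner product property.
   Context: All matrices are real; $\circ$ denotes the Hadamard product. A matrix $M\in\mathbb{R}^{m\times n}$ with $m\le n$ has the strong inner product property (SIPP) if $M$ has rank $m$ and $X=O$ is the only symmetric $m\times m$ matrix $X$ with $(XM)\circ M=O$. -}

module Defs where

open import Level using (Level; _⊔_) renaming (suc to lsuc)
open import Data.Nat using (ℕ; _≤_; _<_)
open import Data.Nat.Properties using (_<?_)
open import Data.Fin using (Fin; toℕ; fromℕ<)
open import Data.Product using (Σ; _×_; ∃)
open import Relation.Nullary using (¬_; yes; no)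
open import Relation.Unary using (Pred)
open import Relation.Binary.Structures using (IsStrictTotalOrder)
open import Algebra.Bundles using (CommutativeRing)
import Algebra.Properties.Monoid.Sum as MonoidSum

-- An axiomatization of the real numbers: a (Dedekind-)complete ordered
-- field.  Every model is isomorphic to ℝ, so quantifying over all models
-- is the same as speaking about ℝ.

record RealField (c ℓ : Level) : Set (lsuc (c ⊔ ℓ)) where
  field
    commutativeRing : CommutativeRing c ℓ
  open CommutativeRing commutativeRing public
  field
    _<ᵣ_              : Carrier → Carrier → Set ℓ
    isStrictTotalOrder : IsStrictTotalOrder _≈_ _<ᵣ_
    0<1               : 0# <ᵣ 1#
    +-mono-<          : ∀ {x y} z → x <ᵣ y → (x + z) <ᵣ (y + z)
    *-pos             : ∀ {x y} → 0# <ᵣ x → 0# <ᵣ y → 0# <ᵣ (x * y)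
    inverse           : ∀ x → ¬ (x ≈ 0#) → ∃ λ y → (x * y) ≈ 1#
    lub : (S : Pred Carrier ℓ) → (∃ λ x → S x) →
          (∃ λ b → ∀ x → S x → ¬ (b <ᵣ x)) →
          ∃ λ s → (∀ x → S x → ¬ (s <ᵣ x)) ×
                  (∀ b → (∀ x → S x → ¬ (b <ᵣ x)) → ¬ (b <ᵣ s))

module Matrices {c ℓ : Level} (ℝ : RealField c ℓ) where
  open RealField ℝ
  open MonoidSum +-monoid using (sum)

  Matrix : ℕ → ℕ → Set c
  Matrix m n = Fin m → Fin n → Carrier

  _⊗_ : ∀ {m k n} → Matrix m k → Matrix k n → Matrix m n
  (X ⊗ Y) i j = sum (λ l → X i l * Y l j)

  _∘ₕ_ : ∀ {m n} → Matrix m n → Matrix m n → Matrix m n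
  (X ∘ₕ Y) i j = X i j * Y i j

  IsZero : ∀ {m n} → Matrix m n → Set ℓ
  IsZero X = ∀ i j → X i j ≈ 0#

  Symmetric : ∀ {m} → Matrix m m → Set ℓ
  Symmetric X = ∀ i j → X i j ≈ X j i

  -- rank M = m  (for M ∈ ℝ^{m×n}): the m rows of M are linearly independent,
  -- i.e. yᵀ M = 0 implies y = 0.
  HasRankRows : ∀ {m n} → Matrix m n → Set (c ⊔ ℓ)
  HasRankRows {m} {n} M =
    (y : Fin m → Carrier) → (∀ j → sum (λ i → y i * M i j) ≈ 0#) → ∀ i → y i ≈ 0#

  SIPP : ∀ {m n} → Matrix m n → Set (c ⊔ ℓ)
  SIPP {m} M = HasRankRows M ×
    ((X : Matrix m m) → Symmetric X → IsZero ((X ⊗ M) ∘ₕ M) → IsZero X)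

  padZero : ∀ {m n} → Matrix m n → (p : ℕ) → Matrix m p
  padZero {n = n} A p i j with toℕ j <? n
  ... | yes j<n = A i (fromℕ< j<n)
  ... | no _    = 0#

-- Both conditions in the strong inner product property constrain a matrix one column
-- at a time, and a zero column satisfies either constraint outright.  Hence SIPP only
-- depends on the set of nonzero columns, which [ A | O ] shares with A.

module Submission where

open import Defs
open import Level using (Level)
open import Data.Nat using (ℕ; _≤_; _<_)
open import Data.Nat.Properties using (_<?_; <⇒≤)
open import Data.Product using (_,_; ∃)
open import Data.Sum using (_⊎_; inj₁; inj₂)
open import Data.Empty using (⊥-elim)
open import Data.Fin using (Fin; toℕ; fromℕ<; inject≤)
open import Data.Fin.Properties using (toℕ-inject≤; toℕ<n; fromℕ<-cong; fromℕ<-toℕ)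
open import Relation.Nullary using (yes; no)
open import Relation.Binary.PropositionalEquality as ≡ using (_≡_)
open import Function.Bundles using (_⇔_; mk⇔)
import Algebra.Properties.Monoid.Sum as MonoidSum
import Relation.Binary.Reasoning.Setoid as SetoidReasoning

module _ {c ℓ : Level} (ℝ : RealField c ℓ) where
  open RealField ℝ
  open Matrices ℝ
  open MonoidSum +-monoid using (sum; sum-cong-≋; sum-replicate-zero)

  SameColumn : ∀ {m k l} → Matrix m k → Fin k → Matrix m l → Fin l → Set ℓ
  SameColumn M j N j′ = ∀ i → M i j ≈ N i j′

  ZeroColumn : ∀ {m k} → Matrix m k → Fin k → Set ℓ
  ZeroColumn M j = ∀ i → M i j ≈ 0#

  ColumnsWithin : ∀ {m k l} → Matrix m k → Matrix m l → Set ℓ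
  ColumnsWithin M N = ∀ j → (∃ λ j′ → SameColumn M j N j′) ⊎ ZeroColumn M j

  module _ {m k l : ℕ} {M : Matrix m k} {N : Matrix m l} where

    rowCombination-cong : ∀ (y : Fin m → Carrier) {j j′} → SameColumn M j N j′ →
                          sum (λ i → y i * M i j) ≈ sum (λ i → y i * N i j′)
    rowCombination-cong y same = sum-cong-≋ (λ i → *-congˡ (same i))

    hadamardEntry-cong : ∀ (X : Matrix m m) i {j j′} → SameColumn M j N j′ →
                         ((X ⊗ M) ∘ₕ M) i j ≈ ((X ⊗ N) ∘ₕ N) i j′
    hadamardEntry-cong X i same =
      *-cong (sum-cong-≋ (λ l → *-congˡ (same l))) (same i)

  module _ {m k : ℕ} {M : Matrix m k} where

    rowCombination-zeroColumn : ∀ (y : Fin m → Carrier) {j} → ZeroColumn M j →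
                                sum (λ i → y i * M i j) ≈ 0#
    rowCombination-zeroColumn y {j} zero-j = begin
      sum (λ i → y i * M i j) ≈⟨ sum-cong-≋ (λ i → trans (*-congˡ (zero-j i)) (zeroʳ (y i))) ⟩
      sum {m} (λ _ → 0#)      ≈⟨ sum-replicate-zero m ⟩
      0#                      ∎
      where open SetoidReasoning setoid

    hadamardEntry-zeroColumn : ∀ (X : Matrix m m) i {j} → ZeroColumn M j →
                               ((X ⊗ M) ∘ₕ M) i j ≈ 0#
    hadamardEntry-zeroColumn X i {j} zero-j =
      trans (*-congˡ (zero-j i)) (zeroʳ ((X ⊗ M) i j))

  SIPP-columnsWithin : ∀ {m k l} {M : Matrix m k} {N : Matrix m l} →
                       ColumnsWithin M N → SIPP M → SIPP N
  SIPP-columnsWithin {M = M} {N} within (rank , sipp) = rankN , sippN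
    where
    rankN : HasRankRows N
    rankN y y-kills-N = rank y y-kills-M
      where
      y-kills-M : ∀ j → sum (λ i → y i * M i j) ≈ 0#
      y-kills-M j with within j
      ... | inj₁ (j′ , same) = trans (rowCombination-cong {M = M} {N = N} y same) (y-kills-N j′)
      ... | inj₂ zero-j      = rowCombination-zeroColumn {M = M} y zero-j

    sippN : (X : Matrix _ _) → Symmetric X → IsZero ((X ⊗ N) ∘ₕ N) → IsZero X
    sippN X symmetric zeroN = sipp X symmetric zeroM
      where
      zeroM : IsZero ((X ⊗ M) ∘ₕ M)
      zeroM i j with within j
      ... | inj₁ (j′ , same) = trans (hadamardEntry-cong {M = M} {N = N} X i same) (zeroN i j′)
      ... | inj₂ zero-j      = hadamardEntry-zeroColumn {M = M} X i zero-j

  module _ {m n : ℕ} (A : Matrix m n) {p : ℕ} (n≤p : n ≤ p) where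

    padZero-inject≤ : ∀ i k → padZero A p i (inject≤ k n≤p) ≡ A i k
    padZero-inject≤ i k with toℕ (inject≤ k n≤p) <? n
    ... | yes k<n = ≡.cong (A i) (≡.trans
            (fromℕ<-cong _ _ (toℕ-inject≤ k n≤p) k<n (toℕ<n k)) (fromℕ<-toℕ k (toℕ<n k)))
    ... | no k≮n = ⊥-elim (k≮n (≡.subst (_< n) (≡.sym (toℕ-inject≤ k n≤p)) (toℕ<n k)))

    columnsWithin-padZero : ColumnsWithin A (padZero A p)
    columnsWithin-padZero k = inj₁ (inject≤ k n≤p , λ i → reflexive (≡.sym (padZero-inject≤ i k)))

  padZero-columnsWithin : ∀ {m n} (A : Matrix m n) p → ColumnsWithin (padZero A p) A
  padZero-columnsWithin {n = n} A p j with toℕ j <? n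
  ... | yes j<n = inj₁ (fromℕ< j<n , λ _ → refl)
  ... | no _    = inj₂ (λ _ → refl)

proposition3p10 : {c ℓ : Level} (ℝ : RealField c ℓ) → let open Matrices ℝ in
    (m n p : ℕ) (A : Matrix m n) → m ≤ n → n < p →
    SIPP A ⇔ SIPP (padZero A p)
proposition3p10 ℝ m n p A _ n<p = mk⇔
  (SIPP-columnsWithin ℝ (columnsWithin-padZero ℝ A (<⇒≤ n<p)))
  (SIPP-columnsWithin ℝ (padZero-columnsWithin ℝ A p))
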